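{- Let $G=(V,E)$ and $G'=(V',E')$ be directed acyclic graphs, let $\chi=(\mathfrak m,\mathfrak M)$ be a monitor placement for $G$, and let $f:V\to V'$ be a bijective, distance-preserving embedding $G\hookrightarrow_f G'$; equip $G'$ with $\chi^f=(f(\mathfrak m),f(\mathfrak M))$. Then $\mu(G\mid\chi)=\mu(G'\mid\chi^f)$.
   Context: For a DAG $G$, $u\preceq_G v$ means $v$ is reachable from $u$ by a directed path (including $u=v$). An embedding is an injective map $f$ with $u\preceq_G v$ iff $f(u)\preceq_{G'} f(v)$. $d_G(x,y)$ is the length of a shortest directed path from $x$ to $y$ ($\infty$ if none); $f$ is distance-preserving if $d_G(x,y)=d_{G'}(f(x),f(y))$ for all $x,y$. A monitor placement specifies input nodes $\mathfrak m$ and output nodes $\mathfrak M$; the measurement paths are the directed paths from a node of $\mathfrak m$ to a node of $\mathfrak M$ (under $\mathrm{CSP}$: simple paths with distinct endpoints; under $\mathrm{CAP}^-$: all such directed walks except single-node paths on a node of $\mathfrak m\cap\mathfrak M$). $\mathbb P(v)$ is the set of measurement paths through $v$, $\mathbb P(U)=\bigcup_{u\in U}\mathbb P(u)$; the node set is $k$-identifiable if for all $U\ne W$ with $|U|,|W|\le k$, $\mathbb P(U)\neq\mathbb P(W)$; $\mu$ is the largest such $k\ge0$. -}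

module Defs where

open import Data.Nat using (ℕ; suc; _≤_)
open import Data.Fin using (Fin)
open import Data.Fin.Subset using (Subset; _∈_; ∣_∣)
open import Data.List using (List; []; _∷_; length)
import Data.List.Membership.Propositional as LM
open import Data.List.Relation.Unary.Unique.Propositional using (Unique)
open import Data.Product using (Σ; ∃; ∃-syntax; _×_; _,_)
open import Relation.Nullary using (¬_)
open import Relation.Binary.PropositionalEquality using (_≡_; _≢_)
open import Relation.Binary.Construct.Closure.ReflexiveTransitive using (Star)
open import Relation.Binary.Construct.Closure.Transitive using (TransClosure)
open import Function.Bundles using (_⇔_)
open import Function.Definitions using (Injective; Bijective)

record Digraph : Set₁ where
  field
    n : ℕ
    E : Fin n → Fin n → Set
open Digraph public

V : Digraph → Set
V G = Fin (n G)

IsDAG : Digraph → Set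
IsDAG G = ∀ (v : V G) → ¬ TransClosure (E G) v v

_⊢_⪯_ : (G : Digraph) → V G → V G → Set
G ⊢ u ⪯ v = Star (E G) u v

-- Walk G x y p : p (list of visited nodes, including both ends) is a
-- directed walk from x to y; it has (length p - 1) edges.
data Walk (G : Digraph) : V G → V G → List (V G) → Set where
  single : ∀ {x} → Walk G x x (x ∷ [])
  step   : ∀ {x y z p} → E G x y → Walk G y z p → Walk G x z (x ∷ p)

HasPathLen : (G : Digraph) → V G → V G → ℕ → Set
HasPathLen G x y k = ∃[ p ] (Walk G x y p × length p ≡ suc k)

-- d_G(x,y) = k  (finite distance); d_G(x,y) = ∞ iff no k satisfies this
IsDist : (G : Digraph) → V G → V G → ℕ → Set
IsDist G x y k = HasPathLen G x y k × (∀ j → HasPathLen G x y j → k ≤ j)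

IsEmbedding : (G G' : Digraph) → (V G → V G') → Set
IsEmbedding G G' f =
  Injective _≡_ _≡_ f × (∀ u v → (G ⊢ u ⪯ v) ⇔ (G' ⊢ f u ⪯ f v))

DistPreserving : (G G' : Digraph) → (V G → V G') → Set
DistPreserving G G' f = ∀ x y k → IsDist G x y k ⇔ IsDist G' (f x) (f y) k

record Placement (G : Digraph) : Set₁ where
  field
    inputs  : V G → Set
    outputs : V G → Set
open Placement public

Image : {A B : Set} → (A → B) → (A → Set) → B → Set
Image {A} f P b = Σ A (λ a → P a × f a ≡ b)

pushPlacement : (G G' : Digraph) → (V G → V G') → Placement G → Placement G'
pushPlacement G G' f χ = record
  { inputs  = Image f (inputs χ)
  ; outputs = Image f (outputs χ) }

data Mechanism : Set where
  CSP CAP⁻ : Mechanism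

MeasPath : Mechanism → (G : Digraph) → Placement G → List (V G) → Set
MeasPath CSP G χ p =
  ∃[ x ] ∃[ y ] (inputs χ x × outputs χ y × Walk G x y p × Unique p × x ≢ y)
MeasPath CAP⁻ G χ p =
  ∃[ x ] ∃[ y ] (inputs χ x × outputs χ y × Walk G x y p ×
    ¬ (∃[ v ] (p ≡ v ∷ [] × inputs χ v × outputs χ v)))

InP : Mechanism → (G : Digraph) → Placement G → Subset (n G) → List (V G) → Set
InP mech G χ U p = MeasPath mech G χ p × ∃[ u ] (u ∈ U × u LM.∈ p)

Identifiable : Mechanism → (G : Digraph) → Placement G → ℕ → Set
Identifiable mech G χ k =
  ∀ (U W : Subset (n G)) → ∣ U ∣ ≤ k → ∣ W ∣ ≤ k → U ≢ W →
    ¬ (∀ p → InP mech G χ U p ⇔ InP mech G χ W p)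

IsMu : Mechanism → (G : Digraph) → Placement G → ℕ → Set
IsMu mech G χ m = Identifiable mech G χ m × ¬ Identifiable mech G χ (suc m)

module Submission where

-- In a DAG there are no self-loops, so x → y is an edge exactly when
-- d(x,y) = 1.  Hence a distance-preserving bijection f : G → G' preserves and
-- reflects edges, and (by definition of χ^f) input and output nodes: it is an
-- isomorphism of graphs with monitor placements.  Everything in the definition
-- of identifiability (walks, simplicity, endpoints, node sets and their sizes)
-- is expressed through this structure, so it is carried over unchanged.

open import Defs
open import Data.Nat using (ℕ; zero; suc; _≤_; z≤n; s≤s)
open import Data.Nat.Properties using (+-0-commutativeMonoid; ≤-trans; ≤-reflexive)
open import Data.Bool using (Bool; true; false)
open import Data.Product using (_×_; _,_; proj₁; proj₂; ∃-syntax)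
open import Data.Empty using (⊥-elim)
open import Data.Fin using (Fin)
open import Data.Fin.Subset using (Subset; ∣_∣)
import Data.Fin.Subset as Subset
open import Data.Fin.Permutation using (permutation)
open import Data.Vec using ([]; _∷_; lookup; tabulate)
open import Data.Vec.Properties using (lookup∘tabulate; tabulate∘lookup; tabulate-cong; []=⇒lookup; lookup⇒[]=)
open import Data.List using (List; []; _∷_; map; length)
open import Data.List.Properties using (map-∘; map-cong; map-id)
open import Data.List.Membership.Propositional.Properties using (∈-map⁺)
open import Data.List.Relation.Unary.Unique.Propositional.Properties using (map⁺)
open import Relation.Binary.Construct.Closure.Transitive using ([_])
open import Function.Base using (_∘_)
open import Function.Bundles using (_⇔_; mk⇔; Equivalence)
open import Function.Definitions using (Bijective)
open import Relation.Binary.PropositionalEquality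
open import Relation.Nullary using (¬_)
import Algebra.Properties.CommutativeMonoid.Sum as Sum
open Sum +-0-commutativeMonoid using (sum; sum-permute; sum-cong-≗)

open Equivalence using (to; from)

walk-two⇒edge : ∀ {G x y p} → Walk G x y p → length p ≡ 2 → E G x y
walk-two⇒edge (step e single)              _  = e
walk-two⇒edge (step _ (step _ single))     ()
walk-two⇒edge (step _ (step _ (step _ _))) ()

dist-one⇒edge : ∀ {G x y} → IsDist G x y 1 → E G x y
dist-one⇒edge ((_ , w , len) , _) = walk-two⇒edge w len

-- In a DAG every edge joins two nodes at distance exactly one: a shortest
-- path of length zero would force the edge to be a self-loop.
edge⇒dist-one : ∀ {G x y} → IsDAG G → E G x y → IsDist G x y 1
edge⇒dist-one {G} {x} {y} dag e = (x ∷ y ∷ [] , step e single , refl) , minimal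
  where
  minimal : ∀ j → HasPathLen G x y j → 1 ≤ j
  minimal zero    (_ , single , _) = ⊥-elim (dag x [ e ])
  minimal zero    (_ , step _ single , ())
  minimal zero    (_ , step _ (step _ _) , ())
  minimal (suc j) _ = s≤s z≤n

record PlacedIso (A B : Digraph) (χA : Placement A) (χB : Placement B) : Set where
  field
    fwd      : V A → V B
    bwd      : V B → V A
    bwd∘fwd  : ∀ x → bwd (fwd x) ≡ x
    fwd∘bwd  : ∀ y → fwd (bwd y) ≡ y
    edge⁺    : ∀ {x y} → E A x y → E B (fwd x) (fwd y)
    edge⁻    : ∀ {x y} → E B (fwd x) (fwd y) → E A x y
    input⁺   : ∀ {x} → inputs χA x → inputs χB (fwd x)
    input⁻   : ∀ {x} → inputs χB (fwd x) → inputs χA x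
    output⁺  : ∀ {x} → outputs χA x → outputs χB (fwd x)
    output⁻  : ∀ {x} → outputs χB (fwd x) → outputs χA x

  fwd-injective : ∀ {x y} → fwd x ≡ fwd y → x ≡ y
  fwd-injective {x} {y} eq = trans (sym (bwd∘fwd x)) (trans (cong bwd eq) (bwd∘fwd y))

  map-bwd∘fwd : ∀ (q : List (V B)) → map fwd (map bwd q) ≡ q
  map-bwd∘fwd q = trans (sym (map-∘ q)) (trans (map-cong fwd∘bwd q) (map-id q))

open PlacedIso

inverse : ∀ {A B χA χB} → PlacedIso A B χA χB → PlacedIso B A χB χA
inverse {B = B} {χB = χB} I = record
  { fwd = bwd I ; bwd = fwd I ; bwd∘fwd = fwd∘bwd I ; fwd∘bwd = bwd∘fwd I
  ; edge⁺   = λ e → edge⁻ I (subst₂ (E B) (sym (fwd∘bwd I _)) (sym (fwd∘bwd I _)) e)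
  ; edge⁻   = λ e → subst₂ (E B) (fwd∘bwd I _) (fwd∘bwd I _) (edge⁺ I e)
  ; input⁺  = λ i → input⁻ I (subst (inputs χB) (sym (fwd∘bwd I _)) i)
  ; input⁻  = λ i → subst (inputs χB) (fwd∘bwd I _) (input⁺ I i)
  ; output⁺ = λ o → output⁻ I (subst (outputs χB) (sym (fwd∘bwd I _)) o)
  ; output⁻ = λ o → subst (outputs χB) (fwd∘bwd I _) (output⁺ I o)
  }

-- reindex σ X = σ⁻¹(X); for a bijection σ = f⁻¹ this is the image f(X).
reindex : ∀ {m n} → (Fin m → Fin n) → Subset n → Subset m
reindex σ X = tabulate (λ i → lookup X (σ i))

lookup-reindex : ∀ {m n} (σ : Fin m → Fin n) X i → lookup (reindex σ X) i ≡ lookup X (σ i)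
lookup-reindex σ X = lookup∘tabulate (λ i → lookup X (σ i))

∈-reindex⁺ : ∀ {m n} (σ : Fin m → Fin n) {X u} → σ u Subset.∈ X → u Subset.∈ reindex σ X
∈-reindex⁺ σ {X} {u} σu∈X =
  lookup⇒[]= u (reindex σ X) (trans (lookup-reindex σ X u) ([]=⇒lookup σu∈X))

∈-reindex⁻ : ∀ {m n} (σ : Fin m → Fin n) {X u} → u Subset.∈ reindex σ X → σ u Subset.∈ X
∈-reindex⁻ σ {X} {u} u∈X =
  lookup⇒[]= (σ u) X (trans (sym (lookup-reindex σ X u)) ([]=⇒lookup u∈X))

indicator : Bool → ℕ
indicator true  = 1
indicator false = 0

∣∣≡sum : ∀ {n} (X : Subset n) → ∣ X ∣ ≡ sum (λ i → indicator (lookup X i))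
∣∣≡sum []          = refl
∣∣≡sum (true ∷ X)  = cong suc (∣∣≡sum X)
∣∣≡sum (false ∷ X) = ∣∣≡sum X

-- Reindexing along a bijection is a permutation of the indicator sum.
∣reindex∣ : ∀ {m n} (σ : Fin m → Fin n) (τ : Fin n → Fin m) →
  (∀ y → σ (τ y) ≡ y) → (∀ x → τ (σ x) ≡ x) → ∀ X → ∣ reindex σ X ∣ ≡ ∣ X ∣
∣reindex∣ σ τ σ∘τ τ∘σ X = begin
  ∣ reindex σ X ∣                                ≡⟨ ∣∣≡sum (reindex σ X) ⟩
  sum (λ i → indicator (lookup (reindex σ X) i)) ≡⟨ sum-cong-≗ (cong indicator ∘ lookup-reindex σ X) ⟩
  sum (λ i → indicator (lookup X (σ i)))         ≡⟨ sum-permute indicatorX (permutation σ τ σ∘τ τ∘σ) ⟨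
  sum indicatorX                                 ≡⟨ ∣∣≡sum X ⟨
  ∣ X ∣                                          ∎
  where
  open ≡-Reasoning
  indicatorX : Fin _ → ℕ
  indicatorX j = indicator (lookup X j)

reindex-injective : ∀ {m n} (σ : Fin m → Fin n) (τ : Fin n → Fin m) →
  (∀ y → σ (τ y) ≡ y) → ∀ {X Y} → reindex σ X ≡ reindex σ Y → X ≡ Y
reindex-injective σ τ σ∘τ {X} {Y} eq =
  trans (sym (tabulate∘lookup X)) (trans (tabulate-cong pointwise) (tabulate∘lookup Y))
  where
  open ≡-Reasoning
  pointwise : ∀ y → lookup X y ≡ lookup Y y
  pointwise y = begin
    lookup X y                   ≡⟨ cong (lookup X) (σ∘τ y) ⟨
    lookup X (σ (τ y))           ≡⟨ lookup-reindex σ X (τ y) ⟨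
    lookup (reindex σ X) (τ y)   ≡⟨ cong (λ Z → lookup Z (τ y)) eq ⟩
    lookup (reindex σ Y) (τ y)   ≡⟨ lookup-reindex σ Y (τ y) ⟩
    lookup Y (σ (τ y))           ≡⟨ cong (lookup Y) (σ∘τ y) ⟩
    lookup Y y                   ∎

module _ {A B χA χB} (I : PlacedIso A B χA χB) where

  image : Subset (n A) → Subset (n B)
  image = reindex (bwd I)

  ∣image∣ : ∀ X → ∣ image X ∣ ≡ ∣ X ∣
  ∣image∣ = ∣reindex∣ (bwd I) (fwd I) (bwd∘fwd I) (fwd∘bwd I)

  image-injective : ∀ {X Y} → image X ≡ image Y → X ≡ Y
  image-injective = reindex-injective (bwd I) (fwd I) (bwd∘fwd I)

  ∈-image : ∀ {X u} → u Subset.∈ X → fwd I u Subset.∈ image X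
  ∈-image {X} u∈X = ∈-reindex⁺ (bwd I) (subst (Subset._∈ X) (sym (bwd∘fwd I _)) u∈X)

  map-walk : ∀ {x y p} → Walk A x y p → Walk B (fwd I x) (fwd I y) (map (fwd I) p)
  map-walk single     = single
  map-walk (step e w) = step (edge⁺ I e) (map-walk w)

  map-singleton : ∀ {p v} → map (fwd I) p ≡ v ∷ [] → ∃[ a ] (p ≡ a ∷ [] × fwd I a ≡ v)
  map-singleton {a ∷ []} refl = a , refl , refl

  map-measPath : ∀ mech {p} → MeasPath mech A χA p → MeasPath mech B χB (map (fwd I) p)
  map-measPath CSP (x , y , ix , oy , w , unique , x≢y) =
    fwd I x , fwd I y , input⁺ I ix , output⁺ I oy , map-walk w ,
    map⁺ (fwd-injective I) unique , λ eq → x≢y (fwd-injective I eq)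
  map-measPath CAP⁻ {p} (x , y , ix , oy , w , notTrivial) =
    fwd I x , fwd I y , input⁺ I ix , output⁺ I oy , map-walk w , trivial⇒
    where
    trivial⇒ : ¬ (∃[ v ] (map (fwd I) p ≡ v ∷ [] × inputs χB v × outputs χB v))
    trivial⇒ (v , eq , iv , ov) with map-singleton eq
    ... | a , refl , refl = notTrivial (a , refl , input⁻ I iv , output⁻ I ov)

  map-InP : ∀ mech X Y → (∀ {u} → u Subset.∈ X → fwd I u Subset.∈ Y) →
    ∀ {p} → InP mech A χA X p → InP mech B χB Y (map (fwd I) p)
  map-InP mech X Y X⇒Y (mp , u , u∈X , u∈p) =
    map-measPath mech mp , fwd I u , X⇒Y u∈X , ∈-map⁺ (fwd I) u∈p

-- ℙ(U) ⊆ ℙ(W) in A implies ℙ(f U) ⊆ ℙ(f W) in B: pull a path of B back,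
-- use the inclusion in A, and push it forward again.
image-InP-⊆ : ∀ mech {A B χA χB} (I : PlacedIso A B χA χB) U W →
  (∀ p → InP mech A χA U p → InP mech A χA W p) →
  ∀ q → InP mech B χB (image I U) q → InP mech B χB (image I W) q
image-InP-⊆ mech I U W U⊆W q q∈U =
  subst (InP mech _ _ (image I W)) (map-bwd∘fwd I q)
    (map-InP I mech W (image I W) (∈-image I)
      (U⊆W _ (map-InP (inverse I) mech (image I U) U (∈-reindex⁻ (bwd I)) q∈U)))

-- Two sets U ≠ W of size ≤ k with ℙ(U) = ℙ(W) in A yield the sets
-- f U ≠ f W of the same sizes with ℙ(f U) = ℙ(f W) in B.
identifiable-reflect : ∀ mech {A B χA χB} → PlacedIso A B χA χB →
  ∀ k → Identifiable mech B χB k → Identifiable mech A χA k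
identifiable-reflect mech I k identB U W ∣U∣≤k ∣W∣≤k U≢W samePaths =
  identB (image I U) (image I W)
    (≤-trans (≤-reflexive (∣image∣ I U)) ∣U∣≤k)
    (≤-trans (≤-reflexive (∣image∣ I W)) ∣W∣≤k)
    (λ eq → U≢W (image-injective I eq))
    (λ q → mk⇔ (image-InP-⊆ mech I U W (λ p → to (samePaths p)) q)
                (image-InP-⊆ mech I W U (λ p → from (samePaths p)) q))

identifiable-invariant : ∀ mech {A B χA χB} → PlacedIso A B χA χB →
  ∀ k → Identifiable mech A χA k ⇔ Identifiable mech B χB k
identifiable-invariant mech I k =
  mk⇔ (identifiable-reflect mech (inverse I) k) (identifiable-reflect mech I k)

mu-invariant : ∀ mech {A B χA χB} →
  (∀ k → Identifiable mech A χA k ⇔ Identifiable mech B χB k) →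
  ∀ m → IsMu mech A χA m ⇔ IsMu mech B χB m
mu-invariant mech same m =
  mk⇔ (λ (ident , notNext) → to (same m) ident , λ next → notNext (from (same (suc m)) next))
      (λ (ident , notNext) → from (same m) ident , λ next → notNext (to (same (suc m)) next))

distPreserving⇒iso : ∀ {G G'} → IsDAG G → IsDAG G' → (χ : Placement G) (f : V G → V G') →
  Bijective _≡_ _≡_ f → DistPreserving G G' f → PlacedIso G G' χ (pushPlacement G G' f χ)
distPreserving⇒iso {G} {G'} dag dag' χ f (f-inj , f-surj) distPres = record
  { fwd = f ; bwd = f⁻¹ ; bwd∘fwd = λ x → f-inj (f∘f⁻¹ (f x)) ; fwd∘bwd = f∘f⁻¹
  ; edge⁺   = λ e → dist-one⇒edge (to (distPres _ _ 1) (edge⇒dist-one dag e))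
  ; edge⁻   = λ e → dist-one⇒edge (from (distPres _ _ 1) (edge⇒dist-one dag' e))
  ; input⁺  = λ i → _ , i , refl
  ; input⁻  = λ (a , i , eq) → subst (inputs χ) (f-inj eq) i
  ; output⁺ = λ o → _ , o , refl
  ; output⁻ = λ (a , o , eq) → subst (outputs χ) (f-inj eq) o
  }
  where
  f⁻¹ : V G' → V G
  f⁻¹ y = proj₁ (f-surj y)
  f∘f⁻¹ : ∀ y → f (f⁻¹ y) ≡ y
  f∘f⁻¹ y = proj₂ (f-surj y) refl

corollary2 : (mech : Mechanism) (G G' : Digraph) → IsDAG G → IsDAG G' →
    (χ : Placement G) (f : V G → V G') →
    Bijective _≡_ _≡_ f → IsEmbedding G G' f → DistPreserving G G' f →
    (∀ k → Identifiable mech G χ k ⇔ Identifiable mech G' (pushPlacement G G' f χ) k)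
    × (∀ m → IsMu mech G χ m ⇔ IsMu mech G' (pushPlacement G G' f χ) m)
corollary2 mech G G' dag dag' χ f bij _ distPres =
  sameIdentifiability , mu-invariant mech sameIdentifiability
  where
  sameIdentifiability : ∀ k → Identifiable mech G χ k ⇔ Identifiable mech G' (pushPlacement G G' f χ) k
  sameIdentifiability = identifiable-invariant mech (distPreserving⇒iso {G} {G'} dag dag' χ f bij distPres)
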